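{- Let $n\geq 5$ be odd, let $C_n$ be the cycle with nodes $v_0,\dots,v_{n-1}$ and edges $i=v_iv_{(i+1)\bmod n}$ for $0\leq i<n$, and let $S=\{\{v,w\}: v\neq w,\ vw\notin E(C_n)\}$. Then the inequality $\sum_{e\in E(C_n)}x_e\geq\lceil n/2\rceil$ defines a shared facet of $\mathrm{MultC}(C_n,S)$.
   Context: Given a graph $G=(V,E)$ and $S\subseteq\binom{V}{2}$, an ($S$-)multicut is a set $\delta\subseteq E$ such that for every $\{s,t\}\in S$ the nodes $s$ and $t$ lie in different components of $G-\delta$. For $F\subseteq E$, $x^F\in\mathbb{R}^E$ is its incidence vector. The multicut polytope is $\mathrm{MultC}^{\square}(G,S)=\mathrm{conv}\{x^\delta:\delta\text{ an } S\text{ -multicut}\}$ and the multicut dominant is $\mathrm{MultC}(G,S)=\mathrm{MultC}^{\square}(G,S)+\mathbb{R}^E_{\geq 0}$. A facet-defining inequality of $\mathrm{MultC}(G,S)$ defines a shared facet if it is also facet-defining for $\mathrm{MultC}^{\square}(G,S)$.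
   Formalization: The multicut polytope MultC^□(C_n,S) and the dominant MultC(C_n,S) are taken in ℚ^E rather than ℝ^E, so their faces, validity and affine dimension concern rational points. -}

module Defs where

open import Data.Nat using (ℕ; zero; suc; NonZero)
open import Data.Nat.DivMod using (_mod_)
open import Data.Fin using (Fin; toℕ)
open import Data.Bool using (Bool; true; false)
open import Data.Integer using (+_)
open import Data.Rational using (ℚ; 0ℚ; 1ℚ; _+_; _*_; _≤_)
open import Data.Rational using () renaming (_/_ to _÷ℚ_)
open import Data.Product using (Σ; ∃; _×_; Σ-syntax; ∃-syntax)
open import Data.Sum using (_⊎_)
open import Relation.Binary.PropositionalEquality using (_≡_; _≢_)
open import Relation.Nullary using (¬_)

record Graph : Set where
  field
    nv  : ℕ
    ne  : ℕ
    end₁ : Fin ne → Fin nv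
    end₂ : Fin ne → Fin nv
open Graph public

Joins : (G : Graph) → Fin (ne G) → Fin (nv G) → Fin (nv G) → Set
Joins G e u w = (end₁ G e ≡ u × end₂ G e ≡ w) ⊎ (end₁ G e ≡ w × end₂ G e ≡ u)

EdgeSet : Graph → Set
EdgeSet G = Fin (ne G) → Bool

-- s and t lie in the same component of G - δ
data Connected (G : Graph) (δ : EdgeSet G) (s : Fin (nv G)) : Fin (nv G) → Set where
  here : Connected G δ s s
  step : ∀ {u w} (e : Fin (ne G)) → Connected G δ s u → δ e ≡ false →
         Joins G e u w → Connected G δ s w

-- S ⊆ (V choose 2) given as a (symmetric) relation on nodes
PairSet : Graph → Set₁
PairSet G = Fin (nv G) → Fin (nv G) → Set

IsMulticut : (G : Graph) → PairSet G → EdgeSet G → Set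
IsMulticut G S δ = ∀ s t → S s t → ¬ Connected G δ s t

Vec : ℕ → Set
Vec m = Fin m → ℚ

sumFin : ∀ {k} → (Fin k → ℚ) → ℚ
sumFin {zero}  f = 0ℚ
sumFin {suc k} f = f Fin.zero + sumFin (λ i → f (Fin.suc i))

fromℕℚ : ℕ → ℚ
fromℕℚ k = (+ k) ÷ℚ 1

boolℚ : Bool → ℚ
boolℚ true  = 1ℚ
boolℚ false = 0ℚ

incidence : (G : Graph) → EdgeSet G → Vec (ne G)
incidence G δ e = boolℚ (δ e)

dot : ∀ {m} → Vec m → Vec m → ℚ
dot a x = sumFin (λ j → a j * x j)

PointSet : ℕ → Set₁
PointSet m = Vec m → Set

AffinelyIndependent : ∀ {m k} → (Fin k → Vec m) → Set
AffinelyIndependent {m} {k} p =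
  (λ' : Fin k → ℚ) → sumFin λ' ≡ 0ℚ →
  (∀ j → sumFin (λ i → λ' i * p i j) ≡ 0ℚ) → ∀ i → λ' i ≡ 0ℚ

HasAffIndep : ∀ {m} → PointSet m → ℕ → Set
HasAffIndep {m} P k = Σ[ p ∈ (Fin k → Vec m) ] ((∀ i → P (p i)) × AffinelyIndependent p)

-- dim P = d  (max number of affinely independent points of P is d + 1)
HasDim : ∀ {m} → PointSet m → ℕ → Set
HasDim P d = HasAffIndep P (suc d) × ¬ HasAffIndep P (suc (suc d))

Face : ∀ {m} → PointSet m → Vec m → ℚ → PointSet m
Face P a b x = P x × dot a x ≡ b

FacetDefining : ∀ {m} → PointSet m → Vec m → ℚ → Set
FacetDefining P a b =
  (∀ x → P x → b ≤ dot a x) ×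
  Σ[ d ∈ ℕ ] (HasDim P (suc d) × HasDim (Face P a b) d)

MultCBox : (G : Graph) → PairSet G → PointSet (ne G)
MultCBox G S x =
  Σ[ k ∈ ℕ ] Σ[ δs ∈ (Fin k → EdgeSet G) ] Σ[ λ' ∈ (Fin k → ℚ) ]
    ((∀ i → IsMulticut G S (δs i)) × (∀ i → 0ℚ ≤ λ' i) × sumFin λ' ≡ 1ℚ ×
     (∀ e → x e ≡ sumFin (λ i → λ' i * incidence G (δs i) e)))

MultC : (G : Graph) → PairSet G → PointSet (ne G)
MultC G S x = Σ[ y ∈ Vec (ne G) ] (MultCBox G S y × (∀ e → y e ≤ x e))

SharedFacet : (G : Graph) → PairSet G → Vec (ne G) → ℚ → Set
SharedFacet G S a b = FacetDefining (MultC G S) a b × FacetDefining (MultCBox G S) a b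

cycle : (n : ℕ) → .{{NonZero n}} → Graph
cycle n = record { nv = n ; ne = n ; end₁ = λ i → i ; end₂ = λ i → suc (toℕ i) mod n }

NonAdjacentPairs : (G : Graph) → PairSet G
NonAdjacentPairs G v w = v ≢ w × ¬ (∃[ e ] Joins G e v w)

allOnes : ∀ {m} → Vec m
allOnes _ = 1ℚ

-- With S the non-adjacent pairs of C_n, δ is a multicut exactly when no two consecutive edges
-- survive in C_n − δ. Summing over consecutive pairs then gives 2|δ| ≥ n, so Σ x ≥ ⌈n/2⌉ is valid
-- on both polyhedra. The full edge set and the n sets E − e are affinely independent multicuts,
-- so both polyhedra have dimension n. For odd n, cutting every second edge once around the cycle,
-- starting from a fixed edge, gives n multicuts with exactly ⌈n/2⌉ edges; they are affinely
-- independent, so the face has dimension n − 1. The matching upper bounds on affine dimension come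
-- from Gaussian elimination over ℚ.

module Submission where

open import Defs
open import Algebra.Bundles using (CommutativeRing)
import Algebra.Properties.CommutativeMonoid.Sum as CommutativeMonoidSum
import Algebra.Properties.Semiring.Sum as SemiringSum
open import Data.Bool using (Bool; true; false; not; if_then_else_; T)
open import Data.Bool.Properties using (not-involutive)
open import Data.Empty using (⊥; ⊥-elim)
open import Data.Fin as Fin using (Fin; toℕ; punchIn; punchOut; inject₁; fromℕ)
import Data.Fin.Properties as Finₚ
import Data.Integer as ℤ
import Data.Integer.Properties as ℤₚ
open import Data.Nat as ℕ using (ℕ; zero; suc; NonZero; _≡ᵇ_; _∸_; _%_; ⌈_/2⌉)
import Data.Nat.Coprimality as Coprime
open import Data.Nat.DivMod using (%-distribˡ-+; m%n%n≡m%n; n%n≡0; m<n⇒m%n≡m; m≤n⇒[n∸m]%m≡n%m)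
open import Data.Nat.GeneralisedArithmetic using (iterate)
import Data.Nat.Properties as ℕₚ
open import Data.Product using (∃-syntax; _×_; _,_; proj₂)
open import Data.Rational as ℚ using (ℚ; 0ℚ; 1ℚ; _+_; _*_; -_; _-_; 1/_; _≤_)
import Data.Rational.Properties as ℚₚ
open import Data.Rational.Solver using (module +-*-Solver)
open import Data.Sum as Sum using (_⊎_; inj₁; inj₂)
open import Data.Unit using (tt)
open import Function using (_∘_; case_of_)
open import Relation.Binary.PropositionalEquality
open import Relation.Nullary using (¬_; yes; no)

open +-*-Solver

private
  module ℚΣ = SemiringSum (CommutativeRing.semiring ℚₚ.+-*-commutativeRing)
  module ℕΣ = CommutativeMonoidSum ℕₚ.+-0-commutativeMonoid

sumFin≡sum : ∀ {k} (f : Fin k → ℚ) → sumFin f ≡ ℚΣ.sum f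
sumFin≡sum {zero}  f = refl
sumFin≡sum {suc k} f = cong (f Fin.zero +_) (sumFin≡sum (f ∘ Fin.suc))

sumFin-cong : ∀ {k} {f g : Fin k → ℚ} → (∀ i → f i ≡ g i) → sumFin f ≡ sumFin g
sumFin-cong {f = f} {g} f≗g
  rewrite sumFin≡sum f | sumFin≡sum g = ℚΣ.sum-cong-≗ f≗g

sumFin-zero : ∀ k → sumFin {k} (λ _ → 0ℚ) ≡ 0ℚ
sumFin-zero k rewrite sumFin≡sum {k} (λ _ → 0ℚ) = ℚΣ.sum-replicate-zero k

sumFin-+ : ∀ {k} (f g : Fin k → ℚ) → sumFin (λ i → f i + g i) ≡ sumFin f + sumFin g
sumFin-+ f g rewrite sumFin≡sum (λ i → f i + g i) | sumFin≡sum f | sumFin≡sum g =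
  ℚΣ.∑-distrib-+ f g

sumFin-*ˡ : ∀ {k} a (f : Fin k → ℚ) → sumFin (λ i → a * f i) ≡ a * sumFin f
sumFin-*ˡ a f rewrite sumFin≡sum (λ i → a * f i) | sumFin≡sum f = sym (ℚΣ.*-distribˡ-sum a f)

sumFin-comm : ∀ {k l} (f : Fin k → Fin l → ℚ) →
  sumFin (λ i → sumFin (f i)) ≡ sumFin (λ j → sumFin (λ i → f i j))
sumFin-comm {zero}  {l} f = sym (sumFin-zero l)
sumFin-comm {suc k}     f =
  trans (cong (sumFin (f Fin.zero) +_) (sumFin-comm (f ∘ Fin.suc)))
        (sym (sumFin-+ (f Fin.zero) (λ j → sumFin (λ i → f (Fin.suc i) j))))

sumFin-linear : ∀ {k} a b (f g : Fin k → ℚ) →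
  sumFin (λ i → a * f i + b * g i) ≡ a * sumFin f + b * sumFin g
sumFin-linear a b f g =
  trans (sumFin-+ (λ i → a * f i) (λ i → b * g i)) (cong₂ _+_ (sumFin-*ˡ a f) (sumFin-*ˡ b g))

sumFin-*-distribˡ-+ : ∀ {k} (l f g : Fin k → ℚ) →
  sumFin (λ i → l i * (f i + g i)) ≡ sumFin (λ i → l i * f i) + sumFin (λ i → l i * g i)
sumFin-*-distribˡ-+ l f g =
  trans (sumFin-cong (λ i → ℚₚ.*-distribˡ-+ (l i) (f i) (g i))) (sumFin-+ (λ i → l i * f i) (λ i → l i * g i))

sumFin-mono-≤ : ∀ {k} {f g : Fin k → ℚ} → (∀ i → f i ≤ g i) → sumFin f ≤ sumFin g
sumFin-mono-≤ {zero}  f≤g = ℚₚ.≤-refl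
sumFin-mono-≤ {suc k} f≤g = ℚₚ.+-mono-≤ (f≤g Fin.zero) (sumFin-mono-≤ (f≤g ∘ Fin.suc))

sumFin-select : ∀ {k} (f : Fin k → ℚ) (j : Fin k) →
  sumFin (λ i → f i * boolℚ (toℕ i ≡ᵇ toℕ j)) ≡ f j
sumFin-select {suc k} f Fin.zero = begin
  f Fin.zero * 1ℚ + sumFin (λ i → f (Fin.suc i) * 0ℚ)
    ≡⟨ cong₂ _+_ (ℚₚ.*-identityʳ (f Fin.zero)) (sumFin-cong (λ i → ℚₚ.*-zeroʳ (f (Fin.suc i)))) ⟩
  f Fin.zero + sumFin {k} (λ _ → 0ℚ)  ≡⟨ cong (f Fin.zero +_) (sumFin-zero k) ⟩
  f Fin.zero + 0ℚ                     ≡⟨ ℚₚ.+-identityʳ (f Fin.zero) ⟩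
  f Fin.zero                          ∎
  where open ≡-Reasoning
sumFin-select {suc k} f (Fin.suc j) =
  trans (cong₂ _+_ (ℚₚ.*-zeroʳ (f Fin.zero)) (sumFin-select (f ∘ Fin.suc) j)) (ℚₚ.+-identityˡ _)

dot-allOnes : ∀ {k} (x : Vec k) → dot allOnes x ≡ sumFin x
dot-allOnes x = sumFin-cong (λ i → ℚₚ.*-identityˡ (x i))

Solves : ∀ {r k} → (Fin r → Fin k → ℚ) → (Fin k → ℚ) → Set
Solves c l = ∀ j → sumFin (λ i → l i * c j i) ≡ 0ℚ

NonTrivial : ∀ {k} → (Fin k → ℚ) → Set
NonTrivial l = ∃[ i ] l i ≢ 0ℚ

*-≢0 : ∀ {p q} → p ≢ 0ℚ → q ≢ 0ℚ → p * q ≢ 0ℚ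
*-≢0 {p} {q} p≢0 q≢0 pq≡0 = p≢0 (begin
  p                  ≡⟨ ℚₚ.*-identityʳ p ⟨
  p * 1ℚ             ≡⟨ cong (p *_) (ℚₚ.*-inverseʳ q) ⟨
  p * (q * (1/ q))   ≡⟨ ℚₚ.*-assoc p q (1/ q) ⟨
  (p * q) * (1/ q)   ≡⟨ cong (_* (1/ q)) pq≡0 ⟩
  0ℚ * (1/ q)        ≡⟨ ℚₚ.*-zeroˡ (1/ q) ⟩
  0ℚ                 ∎)
  where
  open ≡-Reasoning
  instance _ = ℚ.≢-nonZero q≢0

firstUnit-solves : ∀ {r k} (c : Fin r → Fin (suc k) → ℚ) → (∀ j → c j Fin.zero ≡ 0ℚ) →
  Solves c (λ i → boolℚ (toℕ i ≡ᵇ 0))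
firstUnit-solves c column₀≡0 j =
  trans (sumFin-cong (λ i → ℚₚ.*-comm (boolℚ (toℕ i ≡ᵇ 0)) (c j i)))
        (trans (sumFin-select (c j) Fin.zero) (column₀≡0 j))

-- Gaussian elimination of the first unknown, using equation p as pivot row.
module Elimination {r} (c : Fin (suc r) → Fin (suc (suc r)) → ℚ) (p : Fin (suc r)) where

  pivot : ℚ
  pivot = c p Fin.zero

  tailValue : (Fin (suc r) → ℚ) → Fin (suc r) → ℚ
  tailValue μ k = sumFin (λ i → μ i * c k (Fin.suc i))

  reduced : Fin r → Fin (suc r) → ℚ
  reduced j i = pivot * c (punchIn p j) (Fin.suc i) - c (punchIn p j) Fin.zero * c p (Fin.suc i)

  lift : (Fin (suc r) → ℚ) → Fin (suc (suc r)) → ℚ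
  lift μ Fin.zero    = - tailValue μ p
  lift μ (Fin.suc i) = μ i * pivot

  lift-value : ∀ μ k → sumFin (λ i → lift μ i * c k i) ≡
                       pivot * tailValue μ k + (- c k Fin.zero) * tailValue μ p
  lift-value μ k = begin
    - tailValue μ p * c k Fin.zero + sumFin (λ i → μ i * pivot * c k (Fin.suc i))
      ≡⟨ cong (- tailValue μ p * c k Fin.zero +_) (trans
           (sumFin-cong (λ i → solve 3 (λ m a x → m :* a :* x := a :* (m :* x)) refl
                                  (μ i) pivot (c k (Fin.suc i))))
           (sumFin-*ˡ pivot (λ i → μ i * c k (Fin.suc i)))) ⟩
    - tailValue μ p * c k Fin.zero + pivot * tailValue μ k
      ≡⟨ solve 3 (λ s y t → :- s :* y :+ t := t :+ :- y :* s) refl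
           (tailValue μ p) (c k Fin.zero) (pivot * tailValue μ k) ⟩
    pivot * tailValue μ k + (- c k Fin.zero) * tailValue μ p ∎
    where open ≡-Reasoning

  reduced-value : ∀ μ j → sumFin (λ i → μ i * reduced j i) ≡
                  pivot * tailValue μ (punchIn p j) + (- c (punchIn p j) Fin.zero) * tailValue μ p
  reduced-value μ j = trans
    (sumFin-cong (λ i → solve 5 (λ m a x y z → m :* (a :* x :- y :* z) := a :* (m :* x) :+ (:- y) :* (m :* z))
                          refl (μ i) pivot (c k (Fin.suc i)) (c k Fin.zero) (c p (Fin.suc i))))
    (sumFin-linear pivot (- c k Fin.zero) (λ i → μ i * c k (Fin.suc i)) (λ i → μ i * c p (Fin.suc i)))
    where k = punchIn p j

  lift-solves : ∀ μ → Solves reduced μ → Solves c (lift μ)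
  lift-solves μ μ-solves k with k Fin.≟ p
  ... | yes refl = trans (lift-value μ p)
                     (solve 2 (λ a t → a :* t :+ (:- a) :* t := con 0ℚ) refl pivot (tailValue μ p))
  ... | no k≢p = begin
    sumFin (λ i → lift μ i * c k i)
      ≡⟨ lift-value μ k ⟩
    pivot * tailValue μ k + (- c k Fin.zero) * tailValue μ p
      ≡⟨ cong (λ k → pivot * tailValue μ k + (- c k Fin.zero) * tailValue μ p) (Finₚ.punchIn-punchOut p≢k) ⟨
    pivot * tailValue μ (punchIn p j) + (- c (punchIn p j) Fin.zero) * tailValue μ p
      ≡⟨ reduced-value μ j ⟨
    sumFin (λ i → μ i * reduced j i)
      ≡⟨ μ-solves j ⟩
    0ℚ ∎
    where
    open ≡-Reasoning
    p≢k = k≢p ∘ sym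
    j = punchOut p≢k

homogeneous-nontrivial : ∀ r (c : Fin r → Fin (suc r) → ℚ) → ∃[ l ] NonTrivial l × Solves c l
homogeneous-nontrivial zero    c = (λ _ → 1ℚ) , (Fin.zero , ℚₚ.1≢0) , λ ()
homogeneous-nontrivial (suc r) c with Finₚ.all? (λ j → c j Fin.zero ℚₚ.≟ 0ℚ)
... | yes column₀≡0 = (λ i → boolℚ (toℕ i ≡ᵇ 0)) , (Fin.zero , ℚₚ.1≢0) , firstUnit-solves c column₀≡0
... | no column₀≢0 with Finₚ.¬∀⟶∃¬ _ _ (λ j → c j Fin.zero ℚₚ.≟ 0ℚ) column₀≢0
... | p , pivot≢0 with homogeneous-nontrivial r (Elimination.reduced c p)
... | μ , (i , μi≢0) , μ-solves =
  lift μ , (Fin.suc i , *-≢0 μi≢0 pivot≢0) , lift-solves μ μ-solves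
  where open Elimination c p

¬affinelyIndependent : ∀ {m} (p : Fin (suc (suc m)) → Vec m) → ¬ AffinelyIndependent p
¬affinelyIndependent {m} p indep with homogeneous-nontrivial (suc m) equations
  where
  equations : Fin (suc m) → Fin (suc (suc m)) → ℚ
  equations Fin.zero    i = 1ℚ
  equations (Fin.suc j) i = p i j
... | l , (i , li≢0) , solves =
  li≢0 (indep l (trans (sumFin-cong (λ i → sym (ℚₚ.*-identityʳ (l i)))) (solves Fin.zero))
                (solves ∘ Fin.suc) i)

-- On the hyperplane Σ x = b the first coordinate is determined by the others.
affinelyIndependent-tail : ∀ {m k} {b} (p : Fin k → Vec (suc m)) → (∀ i → dot allOnes (p i) ≡ b) →
  AffinelyIndependent p → AffinelyIndependent (λ i → p i ∘ Fin.suc)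
affinelyIndependent-tail {m} {k} {b} p onHyperplane indep l Σl≡0 tail≡0 = indep l Σl≡0 coordinate
  where
  rest : Fin k → ℚ
  rest i = sumFin (p i ∘ Fin.suc)
  head≡ : ∀ i → p i Fin.zero ≡ b - rest i
  head≡ i = trans (solve 2 (λ x y → x := x :+ y :- y) refl (p i Fin.zero) (rest i))
                  (cong (_- rest i) (trans (sym (dot-allOnes (p i))) (onHyperplane i)))
  coordinate : ∀ j → sumFin (λ i → l i * p i j) ≡ 0ℚ
  coordinate (Fin.suc j) = tail≡0 j
  coordinate Fin.zero = begin
    sumFin (λ i → l i * p i Fin.zero)
      ≡⟨ sumFin-cong (λ i → trans (cong (l i *_) (head≡ i))
           (trans (solve 3 (λ a b r → a :* (b :- r) := b :* a :+ (:- con 1ℚ) :* (a :* r)) refl (l i) b (rest i))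
                  (cong (λ z → b * l i + (- 1ℚ) * z) (sym (sumFin-*ˡ (l i) (p i ∘ Fin.suc)))))) ⟩
    sumFin (λ i → b * l i + (- 1ℚ) * sumFin (λ j → l i * p i (Fin.suc j)))
      ≡⟨ sumFin-linear b (- 1ℚ) l _ ⟩
    b * sumFin l + (- 1ℚ) * sumFin (λ i → sumFin (λ j → l i * p i (Fin.suc j)))
      ≡⟨ cong₂ (λ u v → b * u + (- 1ℚ) * v) Σl≡0
           (trans (sumFin-comm (λ i j → l i * p i (Fin.suc j)))
                  (trans (sumFin-cong tail≡0) (sumFin-zero m))) ⟩
    b * 0ℚ + (- 1ℚ) * 0ℚ
      ≡⟨ solve 1 (λ b → b :* con 0ℚ :+ (:- con 1ℚ) :* con 0ℚ := con 0ℚ) refl b ⟩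
    0ℚ ∎
    where open ≡-Reasoning

¬HasAffIndep : ∀ {m} (P : PointSet m) → ¬ HasAffIndep P (suc (suc m))
¬HasAffIndep P (p , _ , indep) = ¬affinelyIndependent p indep

¬HasAffIndep-face : ∀ {m} (P : PointSet (suc m)) b → ¬ HasAffIndep (Face P allOnes b) (suc (suc m))
¬HasAffIndep-face P b (p , p∈face , indep) =
  ¬affinelyIndependent (λ i → p i ∘ Fin.suc) (affinelyIndependent-tail p (λ i → proj₂ (p∈face i)) indep)

HasAffIndep-mono : ∀ {m k} {P Q : PointSet m} → (∀ x → P x → Q x) → HasAffIndep P k → HasAffIndep Q k
HasAffIndep-mono P⊆Q (p , p∈P , indep) = p , (λ i → P⊆Q (p i) (p∈P i)) , indep

Face-mono : ∀ {m} {P Q : PointSet m} {a b} → (∀ x → P x → Q x) → ∀ x → Face P a b x → Face Q a b x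
Face-mono P⊆Q x (x∈P , onHyperplane) = P⊆Q x x∈P , onHyperplane

facetDefining-allOnes : ∀ {m} (P : PointSet (suc m)) b → (∀ x → P x → b ≤ dot allOnes x) →
  HasAffIndep P (suc (suc m)) → HasAffIndep (Face P allOnes b) (suc m) → FacetDefining P allOnes b
facetDefining-allOnes {m} P b valid full face =
  valid , m , (full , ¬HasAffIndep P) , (face , ¬HasAffIndep-face P b)

-- allExcept (suc i) omits coordinate i; allExcept 0 omits nothing.
allExcept : ∀ {k} → Fin (suc k) → Fin k → Bool
allExcept i e = not (toℕ i ≡ᵇ toℕ (Fin.suc e))

allExcept-false : ∀ {k} {i : Fin (suc k)} {e} → allExcept i e ≡ false → toℕ i ≡ suc (toℕ e)
allExcept-false {i = i} {e} omitted with toℕ i ≡ᵇ suc (toℕ e) in i≡ᵇ1+e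
... | true = ℕₚ.≡ᵇ⇒≡ (toℕ i) (suc (toℕ e)) (subst T (sym i≡ᵇ1+e) tt)

boolℚ-not : ∀ b → boolℚ (not b) ≡ 1ℚ - boolℚ b
boolℚ-not true  = refl
boolℚ-not false = refl

allExcept-affinelyIndependent : ∀ {k} → AffinelyIndependent (λ i → boolℚ ∘ allExcept {k} i)
allExcept-affinelyIndependent {k} l Σl≡0 coordinate≡0 = l≡0
  where
  coordinate-value : ∀ e → sumFin (λ i → l i * boolℚ (allExcept i e)) ≡ sumFin l - l (Fin.suc e)
  coordinate-value e = begin
    sumFin (λ i → l i * boolℚ (allExcept i e))
      ≡⟨ sumFin-cong (λ i → trans (cong (l i *_) (boolℚ-not (isSuc e i)))
           (solve 2 (λ x b → x :* (con 1ℚ :- b) := con 1ℚ :* x :+ (:- con 1ℚ) :* (x :* b)) refl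
              (l i) (boolℚ (isSuc e i)))) ⟩
    sumFin (λ i → 1ℚ * l i + (- 1ℚ) * (l i * boolℚ (isSuc e i)))
      ≡⟨ sumFin-linear 1ℚ (- 1ℚ) l (λ i → l i * boolℚ (isSuc e i)) ⟩
    1ℚ * sumFin l + (- 1ℚ) * sumFin (λ i → l i * boolℚ (isSuc e i))
      ≡⟨ cong (λ z → 1ℚ * sumFin l + (- 1ℚ) * z) (sumFin-select l (Fin.suc e)) ⟩
    1ℚ * sumFin l + (- 1ℚ) * l (Fin.suc e)
      ≡⟨ solve 2 (λ s x → con 1ℚ :* s :+ (:- con 1ℚ) :* x := s :- x) refl (sumFin l) (l (Fin.suc e)) ⟩
    sumFin l - l (Fin.suc e) ∎
    where
    open ≡-Reasoning
    isSuc : Fin k → Fin (suc k) → Bool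
    isSuc e i = toℕ i ≡ᵇ toℕ (Fin.suc e)
  l∘suc≡0 : ∀ e → l (Fin.suc e) ≡ 0ℚ
  l∘suc≡0 e = begin
    l (Fin.suc e)                      ≡⟨ solve 2 (λ s x → x := s :- (s :- x)) refl (sumFin l) (l (Fin.suc e)) ⟩
    sumFin l - (sumFin l - l (Fin.suc e)) ≡⟨ cong₂ _-_ Σl≡0 (trans (sym (coordinate-value e)) (coordinate≡0 e)) ⟩
    0ℚ - 0ℚ                            ≡⟨⟩
    0ℚ ∎
    where open ≡-Reasoning
  l≡0 : ∀ i → l i ≡ 0ℚ
  l≡0 Fin.zero    = begin
    l Fin.zero                                 ≡⟨ ℚₚ.+-identityʳ (l Fin.zero) ⟨
    l Fin.zero + 0ℚ                            ≡⟨ cong (l Fin.zero +_) (trans (sumFin-cong l∘suc≡0) (sumFin-zero k)) ⟨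
    l Fin.zero + sumFin (l ∘ Fin.suc)          ≡⟨ Σl≡0 ⟩
    0ℚ ∎
    where open ≡-Reasoning
  l≡0 (Fin.suc e) = l∘suc≡0 e

boolℕ : Bool → ℕ
boolℕ true  = 1
boolℕ false = 0

count : ∀ {k} → (Fin k → Bool) → ℕ
count δ = ℕΣ.sum (boolℕ ∘ δ)

sum-ones : ∀ k → ℕΣ.sum {k} (λ _ → 1) ≡ k
sum-ones zero    = refl
sum-ones (suc k) = cong suc (sum-ones k)

length≤sum : ∀ {k} {f : Fin k → ℕ} → (∀ i → 1 ℕ.≤ f i) → k ℕ.≤ ℕΣ.sum f
length≤sum {zero}  1≤f = ℕ.z≤n
length≤sum {suc k} 1≤f = ℕₚ.+-mono-≤ (1≤f Fin.zero) (length≤sum (1≤f ∘ Fin.suc))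

sum-indicator : ∀ {k} (j : Fin k) → ℕΣ.sum {k} (λ i → boolℕ (toℕ j ≡ᵇ toℕ i)) ≡ 1
sum-indicator {suc k} Fin.zero    = cong suc (ℕΣ.sum-replicate-zero k)
sum-indicator {suc k} (Fin.suc j) = sum-indicator j

n≤c+c⇒⌈n/2⌉≤c : ∀ {n c} → n ℕ.≤ c ℕ.+ c → ⌈ n /2⌉ ℕ.≤ c
n≤c+c⇒⌈n/2⌉≤c {n} {c} n≤c+c = subst (⌈ n /2⌉ ℕ.≤_) (sym (ℕₚ.n≡⌈n+n/2⌉ c)) (ℕₚ.⌈n/2⌉-mono n≤c+c)

c+c≡1+n⇒⌈n/2⌉≡c : ∀ {n c} → c ℕ.+ c ≡ suc n → ⌈ n /2⌉ ≡ c
c+c≡1+n⇒⌈n/2⌉≡c {n} {c} c+c≡1+n = trans (cong ℕ.⌊_/2⌋ (sym c+c≡1+n)) (sym (ℕₚ.n≡⌊n+n/2⌋ c))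

boolℚ-+ : ∀ {x y z} → boolℕ x ℕ.+ boolℕ y ≡ suc (boolℕ z) → boolℚ x + boolℚ y ≡ 1ℚ + boolℚ z
boolℚ-+ {true}  {true}  {true}  _ = refl
boolℚ-+ {true}  {false} {false} _ = refl
boolℚ-+ {false} {true}  {false} _ = refl

fromℕℚ≡mkℚ : ∀ k → fromℕℚ k ≡ ℚ.mkℚ (ℤ.+ k) 0 (Coprime.sym (Coprime.1-coprimeTo k))
fromℕℚ≡mkℚ k = ℚₚ.normalize-coprime (Coprime.sym (Coprime.1-coprimeTo k))

fromℕℚ-suc : ∀ k → fromℕℚ (suc k) ≡ 1ℚ + fromℕℚ k
fromℕℚ-suc k = trans (cong (ℚ._/ 1) (cong (ℤ._+_ (ℤ.+ 1)) (sym (ℤₚ.*-identityʳ (ℤ.+ k)))))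
                     (cong₂ _+_ (sym (fromℕℚ≡mkℚ 1)) (sym (fromℕℚ≡mkℚ k)))

fromℕℚ-mono-≤ : ∀ {k l} → k ℕ.≤ l → fromℕℚ k ≤ fromℕℚ l
fromℕℚ-mono-≤ {k} {l} k≤l rewrite fromℕℚ≡mkℚ k | fromℕℚ≡mkℚ l =
  ℚ.*≤* (subst₂ ℤ._≤_ (sym (ℤₚ.*-identityʳ (ℤ.+ k))) (sym (ℤₚ.*-identityʳ (ℤ.+ l))) (ℤ.+≤+ k≤l))

sumFin-boolℚ : ∀ {k} (δ : Fin k → Bool) → sumFin (boolℚ ∘ δ) ≡ fromℕℚ (count δ)
sumFin-boolℚ {zero}  δ = refl
sumFin-boolℚ {suc k} δ with δ Fin.zero
... | true  = trans (cong (1ℚ +_) (sumFin-boolℚ (δ ∘ Fin.suc))) (sym (fromℕℚ-suc (count (δ ∘ Fin.suc))))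
... | false = trans (ℚₚ.+-identityˡ _) (sumFin-boolℚ (δ ∘ Fin.suc))

dot-allOnes-incidence : ∀ G (δ : EdgeSet G) → dot allOnes (incidence G δ) ≡ fromℕℚ (count δ)
dot-allOnes-incidence G δ = trans (dot-allOnes (incidence G δ)) (sumFin-boolℚ δ)

Joins-compose : ∀ G e {s u w} → Joins G e s u → Joins G e u w → w ≡ s ⊎ Joins G e s w
Joins-compose G e (inj₁ (a , b)) (inj₁ (c , d)) = inj₂ (inj₁ (a , d))
Joins-compose G e (inj₁ (a , b)) (inj₂ (c , d)) = inj₁ (trans (sym c) a)
Joins-compose G e (inj₂ (a , b)) (inj₁ (c , d)) = inj₁ (trans (sym d) b)
Joins-compose G e (inj₂ (a , b)) (inj₂ (c , d)) = inj₂ (inj₂ (c , b))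

module _ {G : Graph} {S : PairSet G} where

  incidence∈MultCBox : ∀ {δ} → IsMulticut G S δ → MultCBox G S (incidence G δ)
  incidence∈MultCBox {δ} δ-multicut =
    1 , (λ _ → δ) , (λ _ → 1ℚ) , (λ _ → δ-multicut) , (λ _ → ℚ.*≤* (ℤ.+≤+ ℕ.z≤n)) , refl ,
    (λ e → sym (trans (ℚₚ.+-identityʳ _) (ℚₚ.*-identityˡ _)))

  MultCBox⊆MultC : ∀ x → MultCBox G S x → MultC G S x
  MultCBox⊆MultC x x∈box = x , x∈box , (λ _ → ℚₚ.≤-refl)

  module _ (b : ℕ) (bound : ∀ δ → IsMulticut G S δ → b ℕ.≤ count δ) where

    MultCBox-valid : ∀ x → MultCBox G S x → fromℕℚ b ≤ dot allOnes x
    MultCBox-valid x (_ , δs , λ' , multicut , λ'≥0 , Σλ'≡1 , x≡) = begin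
      fromℕℚ b
        ≡⟨ Σλ'*b≡b ⟨
      sumFin (λ i → λ' i * fromℕℚ b)
        ≤⟨ sumFin-mono-≤ (λ i → ℚₚ.*-monoˡ-≤-nonNeg (λ' i) {{ℚ.nonNegative (λ'≥0 i)}}
                                  (fromℕℚ-mono-≤ (bound (δs i) (multicut i)))) ⟩
      sumFin (λ i → λ' i * fromℕℚ (count (δs i)))
        ≡⟨ sumFin-cong (λ i → cong (λ' i *_) (sumFin-boolℚ (δs i))) ⟨
      sumFin (λ i → λ' i * sumFin (incidence G (δs i)))
        ≡⟨ sumFin-cong (λ i → sumFin-*ˡ (λ' i) (incidence G (δs i))) ⟨
      sumFin (λ i → sumFin (λ e → λ' i * incidence G (δs i) e))
        ≡⟨ sumFin-comm (λ i e → λ' i * incidence G (δs i) e) ⟩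
      sumFin (λ e → sumFin (λ i → λ' i * incidence G (δs i) e))
        ≡⟨ trans (dot-allOnes x) (sumFin-cong x≡) ⟨
      dot allOnes x ∎
      where
      open ℚₚ.≤-Reasoning
      Σλ'*b≡b : sumFin (λ i → λ' i * fromℕℚ b) ≡ fromℕℚ b
      Σλ'*b≡b = trans (sumFin-cong (λ i → ℚₚ.*-comm (λ' i) (fromℕℚ b)))
                (trans (sumFin-*ˡ (fromℕℚ b) λ') (trans (cong (fromℕℚ b *_) Σλ'≡1) (ℚₚ.*-identityʳ _)))

    MultC-valid : ∀ x → MultC G S x → fromℕℚ b ≤ dot allOnes x
    MultC-valid x (y , y∈box , y≤x) = ℚₚ.≤-trans (MultCBox-valid y y∈box)
      (subst₂ _≤_ (sym (dot-allOnes y)) (sym (dot-allOnes x)) (sumFin-mono-≤ y≤x))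

even : ℕ → Bool
even zero    = true
even (suc n) = not (even n)

even-+ : ∀ a b → even (a ℕ.+ b) ≡ (if even a then even b else not (even b))
even-+ zero    b = refl
even-+ (suc a) b rewrite even-+ a b with even a
... | true  = refl
... | false = not-involutive (even b)

odd-suc⇒even : ∀ m → suc m % 2 ≡ 1 → even m ≡ true
odd-suc⇒even zero          _   = refl
odd-suc⇒even (suc (suc m)) odd = trans (not-involutive (even m)) (odd-suc⇒even m odd)

boolℕ-not : ∀ b → boolℕ b ℕ.+ boolℕ (not b) ≡ 1
boolℕ-not true  = refl
boolℕ-not false = refl

[t+k]%n≢t : ∀ {t k n} .{{_ : NonZero n}} → t ℕ.< n → 0 ℕ.< k → k ℕ.< n → (t ℕ.+ k) % n ≢ t
[t+k]%n≢t {t} {k} {n} t<n 0<k k<n eq with ℕₚ.<-≤-connex (t ℕ.+ k) n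
... | inj₁ t+k<n = ℕₚ.<⇒≢ 0<k (sym (ℕₚ.+-cancelˡ-≡ t k 0
       (trans (trans (sym (m<n⇒m%n≡m t+k<n)) eq) (sym (ℕₚ.+-identityʳ t)))))
... | inj₂ n≤t+k = ℕₚ.<⇒≢ k<n (sym (ℕₚ.+-cancelˡ-≡ t n k (trans (cong (ℕ._+ n) (sym d≡t)) d+n≡t+k)))
  where
  d = t ℕ.+ k ∸ n
  d+n≡t+k : d ℕ.+ n ≡ t ℕ.+ k
  d+n≡t+k = ℕₚ.m∸n+n≡m n≤t+k
  d<n : d ℕ.< n
  d<n = ℕₚ.+-cancelʳ-< n d n (subst (ℕ._< n ℕ.+ n) (sym d+n≡t+k) (ℕₚ.+-mono-< t<n k<n))
  d≡t : d ≡ t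
  d≡t = trans (sym (m<n⇒m%n≡m d<n)) (trans (m≤n⇒[n∸m]%m≡n%m n≤t+k) eq)

[m%n+k]%n≡[m+k]%n : ∀ a k n .{{_ : NonZero n}} → (a % n ℕ.+ k) % n ≡ (a ℕ.+ k) % n
[m%n+k]%n≡[m+k]%n a k n = begin
  (a % n ℕ.+ k) % n           ≡⟨ %-distribˡ-+ (a % n) k n ⟩
  (a % n % n ℕ.+ k % n) % n   ≡⟨ cong (λ z → (z ℕ.+ k % n) % n) (m%n%n≡m%n a n) ⟩
  (a % n ℕ.+ k % n) % n       ≡⟨ %-distribˡ-+ a k n ⟨
  (a ℕ.+ k) % n               ∎
  where open ≡-Reasoning

opposite-parity : ∀ d k → even (d ℕ.+ suc k) ≡ true → boolℕ (even d) ℕ.+ boolℕ (even k) ≡ 1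
opposite-parity d k even-sum with even d | even k | trans (sym (even-+ d (suc k))) even-sum
... | true  | false | _  = refl
... | false | true  | _  = refl
... | true  | true  | ()
... | false | false | ()

-- For n odd, alternating k t says that edge t of C_n lies at even forward distance from edge k:
-- for t < k that distance is n − (k − t), which has the parity of 1 + (k − t).
alternating : ℕ → ℕ → Bool
alternating zero    t       = even t
alternating (suc k) zero    = even (suc (suc k))
alternating (suc k) (suc t) = alternating k t

alternating-≤ : ∀ {k t} → k ℕ.≤ t → alternating k t ≡ even (t ∸ k)
alternating-≤ ℕ.z≤n      = refl
alternating-≤ (ℕ.s≤s k≤t) = alternating-≤ k≤t

alternating-suc : ∀ k t →
  boolℕ (alternating k t) ℕ.+ boolℕ (alternating k (suc t)) ≡ suc (boolℕ (k ≡ᵇ suc t))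
alternating-suc zero          t       = boolℕ-not (even t)
alternating-suc (suc zero)    zero    = refl
alternating-suc (suc (suc k)) zero    =
  trans (ℕₚ.+-comm (boolℕ (even (3 ℕ.+ k))) _) (boolℕ-not (even (2 ℕ.+ k)))
alternating-suc (suc k)       (suc t) = alternating-suc k t

alternating-wrap : ∀ {k m} → k ℕ.≤ m → even m ≡ true →
  boolℕ (alternating k m) ℕ.+ boolℕ (alternating k 0) ≡ suc (boolℕ (k ≡ᵇ 0))
alternating-wrap {zero}  _   m-even rewrite m-even = refl
alternating-wrap {suc k} {m} k<m m-even = begin
  boolℕ (alternating (suc k) m) ℕ.+ boolℕ (not (not (even k)))
    ≡⟨ cong₂ (λ a b → boolℕ a ℕ.+ boolℕ b) (alternating-≤ k<m) (not-involutive (even k)) ⟩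
  boolℕ (even (m ∸ suc k)) ℕ.+ boolℕ (even k)
    ≡⟨ opposite-parity (m ∸ suc k) k (trans (cong even (ℕₚ.m∸n+n≡m k<m)) m-even) ⟩
  1 ∎
  where open ≡-Reasoning

inject₁-or-fromℕ : ∀ {m} (e : Fin (suc m)) → (∃[ j ] e ≡ inject₁ j) ⊎ e ≡ fromℕ m
inject₁-or-fromℕ {zero}  Fin.zero    = inj₂ refl
inject₁-or-fromℕ {suc m} Fin.zero    = inj₁ (Fin.zero , refl)
inject₁-or-fromℕ {suc m} (Fin.suc e) with inject₁-or-fromℕ e
... | inj₁ (j , refl) = inj₁ (Fin.suc j , refl)
... | inj₂ refl       = inj₂ refl

module Cycle (m : ℕ) where

  C : Graph
  C = cycle (suc m)

  S : PairSet C
  S = NonAdjacentPairs C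

  next : Fin (suc m) → Fin (suc m)
  next = end₂ C

  toℕ-next : ∀ e → toℕ (next e) ≡ suc (toℕ e) % suc m
  toℕ-next e = Finₚ.toℕ-fromℕ< _

  next-inject₁ : ∀ j → next (inject₁ j) ≡ Fin.suc j
  next-inject₁ j = Finₚ.toℕ-injective (begin
    toℕ (next (inject₁ j))       ≡⟨ toℕ-next (inject₁ j) ⟩
    suc (toℕ (inject₁ j)) % suc m ≡⟨ cong (λ z → suc z % suc m) (Finₚ.toℕ-inject₁ j) ⟩
    suc (toℕ j) % suc m           ≡⟨ m<n⇒m%n≡m (ℕ.s≤s (Finₚ.toℕ<n j)) ⟩
    suc (toℕ j)                   ∎)
    where open ≡-Reasoning

  next-fromℕ : next (fromℕ m) ≡ Fin.zero
  next-fromℕ = Finₚ.toℕ-injective (begin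
    toℕ (next (fromℕ m))       ≡⟨ toℕ-next (fromℕ m) ⟩
    suc (toℕ (fromℕ m)) % suc m ≡⟨ cong (λ z → suc z % suc m) (Finₚ.toℕ-fromℕ m) ⟩
    suc m % suc m               ≡⟨ n%n≡0 (suc m) ⟩
    0                           ∎)
    where open ≡-Reasoning

  prev : Fin (suc m) → Fin (suc m)
  prev Fin.zero    = fromℕ m
  prev (Fin.suc j) = inject₁ j

  next∘prev : ∀ k → next (prev k) ≡ k
  next∘prev Fin.zero    = next-fromℕ
  next∘prev (Fin.suc j) = next-inject₁ j

  prev∘next : ∀ e → prev (next e) ≡ e
  prev∘next e with inject₁-or-fromℕ e
  ... | inj₁ (j , refl) rewrite next-inject₁ j = refl
  ... | inj₂ refl       rewrite next-fromℕ     = refl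

  next-injective : ∀ {e e'} → next e ≡ next e' → e ≡ e'
  next-injective {e} {e'} eq = trans (sym (prev∘next e)) (trans (cong prev eq) (prev∘next e'))

  sum-∘next : (h : Fin (suc m) → ℕ) → ℕΣ.sum (h ∘ next) ≡ ℕΣ.sum h
  sum-∘next h = begin
    ℕΣ.sum (h ∘ next)                                     ≡⟨ ℕΣ.sum-init-last (h ∘ next) ⟩
    ℕΣ.sum (h ∘ next ∘ inject₁) ℕ.+ h (next (fromℕ m))    ≡⟨ cong₂ ℕ._+_ (ℕΣ.sum-cong-≗ (cong h ∘ next-inject₁))
                                                                          (cong h next-fromℕ) ⟩
    ℕΣ.sum (h ∘ Fin.suc) ℕ.+ h Fin.zero                   ≡⟨ ℕₚ.+-comm (ℕΣ.sum (h ∘ Fin.suc)) (h Fin.zero) ⟩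
    ℕΣ.sum h                                              ∎
    where open ≡-Reasoning

  toℕ-iterate-next : ∀ k x → toℕ (iterate next x k) ≡ (toℕ x ℕ.+ k) % suc m
  toℕ-iterate-next zero    x =
    sym (trans (cong (_% suc m) (ℕₚ.+-identityʳ (toℕ x))) (m<n⇒m%n≡m (Finₚ.toℕ<n x)))
  toℕ-iterate-next (suc k) x = begin
    toℕ (iterate next (next x) k)       ≡⟨ toℕ-iterate-next k (next x) ⟩
    (toℕ (next x) ℕ.+ k) % suc m        ≡⟨ cong (λ z → (z ℕ.+ k) % suc m) (toℕ-next x) ⟩
    (suc (toℕ x) % suc m ℕ.+ k) % suc m ≡⟨ [m%n+k]%n≡[m+k]%n (suc (toℕ x)) k (suc m) ⟩
    (suc (toℕ x) ℕ.+ k) % suc m         ≡⟨ cong (_% suc m) (ℕₚ.+-suc (toℕ x) k) ⟨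
    (toℕ x ℕ.+ suc k) % suc m           ∎
    where open ≡-Reasoning

  iterate-next-≢ : ∀ {k} x → 0 ℕ.< k → k ℕ.≤ m → iterate next x k ≢ x
  iterate-next-≢ {k} x 0<k k≤m eq =
    [t+k]%n≢t (Finₚ.toℕ<n x) 0<k (ℕ.s≤s k≤m) (trans (sym (toℕ-iterate-next k x)) (cong toℕ eq))

  NoTwoConsecutiveUncut : EdgeSet C → Set
  NoTwoConsecutiveUncut δ = ∀ e → δ e ≡ false → δ (next e) ≡ false → ⊥

  Joins-source : ∀ {e u w} → Joins C e u w → u ≡ e ⊎ u ≡ next e
  Joins-source (inj₁ (e≡u , _)) = inj₁ (sym e≡u)
  Joins-source (inj₂ (_ , e'≡u)) = inj₂ (sym e'≡u)

  Joins-target : ∀ {e u w} → Joins C e u w → w ≡ e ⊎ w ≡ next e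
  Joins-target (inj₁ (_ , e'≡w)) = inj₂ (sym e'≡w)
  Joins-target (inj₂ (e≡w , _)) = inj₁ (sym e≡w)

  module _ {δ : EdgeSet C} (noTwo : NoTwoConsecutiveUncut δ) where

    uncut-edges-disjoint : ∀ {e e' u} → e ≢ e' → δ e ≡ false → δ e' ≡ false →
      u ≡ e ⊎ u ≡ next e → u ≡ e' ⊎ u ≡ next e' → ⊥
    uncut-edges-disjoint e≢e' _ _ (inj₁ u≡e) (inj₁ u≡e') = e≢e' (trans (sym u≡e) u≡e')
    uncut-edges-disjoint {e' = e'} e≢e' uncut uncut' (inj₁ u≡e) (inj₂ u≡e'⁺) =
      noTwo e' uncut' (subst (λ z → δ z ≡ false) (trans (sym u≡e) u≡e'⁺) uncut)
    uncut-edges-disjoint {e} e≢e' uncut uncut' (inj₂ u≡e⁺) (inj₁ u≡e') =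
      noTwo e uncut (subst (λ z → δ z ≡ false) (trans (sym u≡e') u≡e⁺) uncut')
    uncut-edges-disjoint e≢e' _ _ (inj₂ u≡e⁺) (inj₂ u≡e'⁺) =
      e≢e' (next-injective (trans (sym u≡e⁺) u≡e'⁺))

    connected⇒uncut-edge : ∀ {s t} → Connected C δ s t → t ≡ s ⊎ ∃[ e ] δ e ≡ false × Joins C e s t
    connected⇒uncut-edge here = inj₁ refl
    connected⇒uncut-edge (step e' s~u uncut' joins') with connected⇒uncut-edge s~u
    ... | inj₁ refl = inj₂ (e' , uncut' , joins')
    ... | inj₂ (e , uncut , joins) with e Fin.≟ e'
    ...   | yes refl = Sum.map₂ (λ joins″ → e , uncut , joins″) (Joins-compose C e joins joins')
    ...   | no e≢e'  = ⊥-elim (uncut-edges-disjoint e≢e' uncut uncut' (Joins-target joins) (Joins-source joins'))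

    noTwo⇒multicut : IsMulticut C S δ
    noTwo⇒multicut s t (s≢t , nonAdjacent) s~t with connected⇒uncut-edge s~t
    ... | inj₁ t≡s             = s≢t (sym t≡s)
    ... | inj₂ (e , _ , joins) = nonAdjacent (e , joins)

  module _ (3≤m : 3 ℕ.≤ m) where

    nonAdjacent-next² : ∀ x → S x (next (next x))
    nonAdjacent-next² x = (λ x≡x⁺⁺ → iterate-next-≢ {2} x (ℕ.s≤s ℕ.z≤n) 2≤m (sym x≡x⁺⁺)) , noEdge
      where
      2≤m = ℕₚ.≤-trans (ℕₚ.n≤1+n 2) 3≤m
      noEdge : ¬ (∃[ e ] Joins C e x (next (next x)))
      noEdge (e , inj₁ (refl , x⁺≡x⁺⁺)) =
        iterate-next-≢ {1} (next x) (ℕ.s≤s ℕ.z≤n) (ℕₚ.≤-trans (ℕₚ.n≤1+n 1) 2≤m) (sym x⁺≡x⁺⁺)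
      noEdge (e , inj₂ (refl , x⁺⁺⁺≡x)) = iterate-next-≢ {3} x (ℕ.s≤s ℕ.z≤n) 3≤m x⁺⁺⁺≡x

    multicut⇒noTwo : ∀ {δ} → IsMulticut C S δ → NoTwoConsecutiveUncut δ
    multicut⇒noTwo δ-multicut e uncut uncut⁺ = δ-multicut e (next (next e)) (nonAdjacent-next² e)
      (step (next e) (step e here uncut (inj₁ (refl , refl))) uncut⁺ (inj₁ (refl , refl)))

    -- Every edge together with its successor contributes at least one cut edge, and each edge
    -- is counted twice.
    multicut-count : ∀ δ → IsMulticut C S δ → ⌈ suc m /2⌉ ℕ.≤ count δ
    multicut-count δ δ-multicut = n≤c+c⇒⌈n/2⌉≤c (begin
      suc m                                                     ≤⟨ length≤sum consecutive ⟩
      ℕΣ.sum (λ e → boolℕ (δ e) ℕ.+ boolℕ (δ (next e)))        ≡⟨ ℕΣ.∑-distrib-+ (boolℕ ∘ δ) (boolℕ ∘ δ ∘ next) ⟩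
      count δ ℕ.+ ℕΣ.sum (boolℕ ∘ δ ∘ next)                    ≡⟨ cong (count δ ℕ.+_) (sum-∘next (boolℕ ∘ δ)) ⟩
      count δ ℕ.+ count δ                                       ∎)
      where
      open ℕₚ.≤-Reasoning
      consecutive : ∀ e → 1 ℕ.≤ boolℕ (δ e) ℕ.+ boolℕ (δ (next e))
      consecutive e with δ e in δe | δ (next e) in δe⁺
      ... | true  | _     = ℕ.s≤s ℕ.z≤n
      ... | false | true  = ℕ.s≤s ℕ.z≤n
      ... | false | false = ⊥-elim (multicut⇒noTwo δ-multicut e δe δe⁺)

    allExcept-noTwo : ∀ i → NoTwoConsecutiveUncut (allExcept i)
    allExcept-noTwo i e omitted omitted⁺ = iterate-next-≢ {1} e (ℕ.s≤s ℕ.z≤n) (ℕₚ.≤-trans (ℕ.s≤s ℕ.z≤n) 3≤m)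
      (Finₚ.toℕ-injective (ℕₚ.suc-injective (trans (sym (allExcept-false {i = i} omitted⁺)) (allExcept-false {i = i} omitted))))

    MultCBox-full : HasAffIndep (MultCBox C S) (suc (suc m))
    MultCBox-full = (λ i → incidence C (allExcept i)) ,
                    (λ i → incidence∈MultCBox (noTwo⇒multicut (allExcept-noTwo i))) ,
                    allExcept-affinelyIndependent

  module _ (m-even : even m ≡ true) where

    faceCut : Fin (suc m) → EdgeSet C
    faceCut k e = alternating (toℕ k) (toℕ e)

    faceCut-next : ∀ k e →
      boolℕ (faceCut k e) ℕ.+ boolℕ (faceCut k (next e)) ≡ suc (boolℕ (toℕ k ≡ᵇ toℕ (next e)))
    faceCut-next k e with inject₁-or-fromℕ e
    ... | inj₁ (j , refl) rewrite next-inject₁ j | Finₚ.toℕ-inject₁ j = alternating-suc (toℕ k) (toℕ j)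
    ... | inj₂ refl rewrite next-fromℕ | Finₚ.toℕ-fromℕ m =
      alternating-wrap (ℕₚ.≤-pred (Finₚ.toℕ<n k)) m-even

    faceCut-noTwo : ∀ k → NoTwoConsecutiveUncut (faceCut k)
    faceCut-noTwo k e uncut uncut⁺ with faceCut-next k e
    ... | identity rewrite uncut | uncut⁺ = case identity of λ ()

    faceCut-count : ∀ k → count (faceCut k) ≡ ⌈ suc m /2⌉
    faceCut-count k = sym (c+c≡1+n⇒⌈n/2⌉≡c (begin
      count (faceCut k) ℕ.+ count (faceCut k)
        ≡⟨ cong (count (faceCut k) ℕ.+_) (sum-∘next (boolℕ ∘ faceCut k)) ⟨
      count (faceCut k) ℕ.+ ℕΣ.sum (boolℕ ∘ faceCut k ∘ next)
        ≡⟨ ℕΣ.∑-distrib-+ (boolℕ ∘ faceCut k) (boolℕ ∘ faceCut k ∘ next) ⟨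
      ℕΣ.sum (λ e → boolℕ (faceCut k e) ℕ.+ boolℕ (faceCut k (next e)))
        ≡⟨ ℕΣ.sum-cong-≗ (faceCut-next k) ⟩
      ℕΣ.sum (λ e → 1 ℕ.+ boolℕ (toℕ k ≡ᵇ toℕ (next e)))
        ≡⟨ ℕΣ.∑-distrib-+ (λ _ → 1) (λ e → boolℕ (toℕ k ≡ᵇ toℕ (next e))) ⟩
      ℕΣ.sum {suc m} (λ _ → 1) ℕ.+ ℕΣ.sum (λ e → boolℕ (toℕ k ≡ᵇ toℕ (next e)))
        ≡⟨ cong₂ ℕ._+_ (sum-ones (suc m)) (trans (sum-∘next (λ e → boolℕ (toℕ k ≡ᵇ toℕ e))) (sum-indicator k)) ⟩
      suc m ℕ.+ 1
        ≡⟨ ℕₚ.+-comm (suc m) 1 ⟩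
      suc (suc m) ∎))
      where open ≡-Reasoning

    -- Coordinates e and e + 1 together isolate the coefficient of faceCut (e + 1).
    faceCut-affinelyIndependent : AffinelyIndependent (λ k → incidence C (faceCut k))
    faceCut-affinelyIndependent l Σl≡0 coordinate≡0 k = subst (λ z → l z ≡ 0ℚ) (next∘prev k) (l∘next≡0 (prev k))
      where
      l∘next≡0 : ∀ e → l (next e) ≡ 0ℚ
      l∘next≡0 e = begin
        l (next e)
          ≡⟨ ℚₚ.+-identityˡ (l (next e)) ⟨
        0ℚ + l (next e)
          ≡⟨ cong₂ _+_ (trans (sumFin-cong (λ k → ℚₚ.*-identityʳ (l k))) Σl≡0) (sumFin-select l (next e)) ⟨
        sumFin (λ k → l k * 1ℚ) + sumFin (λ k → l k * boolℚ (toℕ k ≡ᵇ toℕ (next e)))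
          ≡⟨ sumFin-*-distribˡ-+ l (λ _ → 1ℚ) (λ k → boolℚ (toℕ k ≡ᵇ toℕ (next e))) ⟨
        sumFin (λ k → l k * (1ℚ + boolℚ (toℕ k ≡ᵇ toℕ (next e))))
          ≡⟨ sumFin-cong (λ k → cong (l k *_) (boolℚ-+ {faceCut k e} {faceCut k (next e)} (faceCut-next k e))) ⟨
        sumFin (λ k → l k * (boolℚ (faceCut k e) + boolℚ (faceCut k (next e))))
          ≡⟨ sumFin-*-distribˡ-+ l (λ k → boolℚ (faceCut k e)) (λ k → boolℚ (faceCut k (next e))) ⟩
        sumFin (λ k → l k * boolℚ (faceCut k e)) + sumFin (λ k → l k * boolℚ (faceCut k (next e)))
          ≡⟨ cong₂ _+_ (coordinate≡0 e) (coordinate≡0 (next e)) ⟩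
        0ℚ ∎
        where open ≡-Reasoning

    MultCBox-face : HasAffIndep (Face (MultCBox C S) allOnes (fromℕℚ ⌈ suc m /2⌉)) (suc m)
    MultCBox-face = (λ k → incidence C (faceCut k)) ,
                    (λ k → incidence∈MultCBox (noTwo⇒multicut (faceCut-noTwo k)) ,
                           trans (dot-allOnes-incidence C (faceCut k)) (cong fromℕℚ (faceCut-count k))) ,
                    faceCut-affinelyIndependent

  sharedFacet : 3 ℕ.≤ m → even m ≡ true → SharedFacet C S allOnes (fromℕℚ ⌈ suc m /2⌉)
  sharedFacet 3≤m m-even =
    facetDefining-allOnes (MultC C S) _ (MultC-valid _ (multicut-count 3≤m))
      (HasAffIndep-mono MultCBox⊆MultC (MultCBox-full 3≤m))
      (HasAffIndep-mono (Face-mono {a = allOnes} MultCBox⊆MultC) (MultCBox-face m-even)) ,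
    facetDefining-allOnes (MultCBox C S) _ (MultCBox-valid _ (multicut-count 3≤m))
      (MultCBox-full 3≤m) (MultCBox-face m-even)

theorem7p1 : (n : ℕ) .{{_ : NonZero n}} → 5 ℕ.≤ n → n % 2 ≡ 1 →
    SharedFacet (cycle n) (NonAdjacentPairs (cycle n)) allOnes (fromℕℚ ⌈ n /2⌉)
theorem7p1 (suc m) 5≤n n-odd =
  Cycle.sharedFacet m (ℕₚ.<⇒≤ (ℕₚ.≤-pred 5≤n)) (odd-suc⇒even m n-odd)
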